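{- Let $d\ge 1$, let $a_1,\dots,a_d>0$ be real numbers, and let \[ S = \left\{ x \in \mathbb{R}^d \,:\, x_1,\dots,x_d \ge 0,\ \frac{x_1}{a_1} + \cdots + \frac{x_d}{a_d} \le 1 \right\}. \] For every $I \subseteq [d]=\{1,\dots,d\}$ let \[ C_I = \left\{ x \in \mathbb{R}^d \,:\, \sum_{i\in I}\frac{|x_i|}{a_i} \le 1,\ x_j = 0 \text{ for all } j \in [d]\setminus I \right\}. \] Then for every real $t>0$, \[ \left| tS \cap \mathbb{Z}^d \right| = \frac{1}{2^d} \sum_{I \subseteq [d]} \left| tC_I \cap \mathbb{Z}^d \right|. \]
   Context: $tP=\{tx : x\in P\}$ for a set $P\subseteq\mathbb{R}^d$ and $t>0$. -}

module Defs where

open import Data.Nat as ℕ using (ℕ; zero; suc)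
open import Data.Integer as ℤ using (ℤ; +_; -[1+_])
open import Data.Fin using (Fin)
open import Data.Vec as Vec using (Vec; []; _∷_; lookup; tabulate; map; foldr)
open import Data.Fin.Subset using (Subset; Side; inside; outside)
open import Data.List using (List; length)
open import Data.List.Relation.Unary.All using (All)
open import Data.List.Relation.Unary.Unique.Propositional using (Unique)
open import Data.List.Membership.Propositional using (_∈_)
open import Data.Product using (Σ; ∃; _×_)
open import Data.Sum using (_⊎_)
open import Relation.Binary.PropositionalEquality using (_≡_; _≢_)
open import Algebra.Structures using (IsCommutativeRing)
open import Relation.Binary.Structures using (IsTotalOrder)

-- Any two models are isomorphic, so quantifying
-- over all models is the same as speaking about ℝ.
record RealNumbers : Set₁ where
  infixl 6 _+_
  infixl 7 _*_
  infix 4 _≤_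
  field
    ℝ     : Set
    _+_   : ℝ → ℝ → ℝ
    _*_   : ℝ → ℝ → ℝ
    -_    : ℝ → ℝ
    0ℝ    : ℝ
    1ℝ    : ℝ
    _⁻¹   : ℝ → ℝ            -- multiplicative inverse (value at 0 irrelevant)
    _≤_   : ℝ → ℝ → Set
    ∣_∣   : ℝ → ℝ
    isCommutativeRing : IsCommutativeRing _≡_ _+_ _*_ -_ 0ℝ 1ℝ
    0≢1      : 0ℝ ≢ 1ℝ
    ⁻¹-inverse : ∀ x → x ≢ 0ℝ → x * (x ⁻¹) ≡ 1ℝ
    isTotalOrder : IsTotalOrder _≡_ _≤_
    +-mono-≤ : ∀ x y z → x ≤ y → x + z ≤ y + z
    *-nonneg : ∀ x y → 0ℝ ≤ x → 0ℝ ≤ y → 0ℝ ≤ x * y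
    abs-nonneg : ∀ x → 0ℝ ≤ x → ∣ x ∣ ≡ x
    abs-nonpos : ∀ x → x ≤ 0ℝ → ∣ x ∣ ≡ - x
    complete : (P : ℝ → Set) → ∃ P → (∃ λ b → ∀ x → P x → x ≤ b) →
               ∃ λ s → (∀ x → P x → x ≤ s) × (∀ b → (∀ x → P x → x ≤ b) → s ≤ b)

  _<_ : ℝ → ℝ → Set
  x < y = (x ≤ y) × (x ≢ y)

  fromℕ : ℕ → ℝ
  fromℕ zero    = 0ℝ
  fromℕ (suc n) = 1ℝ + fromℕ n

  fromℤ : ℤ → ℝ
  fromℤ (+ n)      = fromℕ n
  fromℤ -[1+ n ]   = - (1ℝ + fromℕ n)

  sumℝ : ∀ {n} → Vec ℝ n → ℝ
  sumℝ = foldr _ _+_ 0ℝ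

  module Simplex {d : ℕ} (a : Vec ℝ d) where
    S : Vec ℝ d → Set
    S x = (∀ i → 0ℝ ≤ lookup x i)
        × (sumℝ (tabulate λ i → lookup x i * (lookup a i ⁻¹)) ≤ 1ℝ)

    C : Subset d → Vec ℝ d → Set
    C I x = (sumℝ (tabulate λ i → sel (lookup I i) (∣ lookup x i ∣ * (lookup a i ⁻¹))) ≤ 1ℝ)
          × (∀ j → lookup I j ≡ outside → lookup x j ≡ 0ℝ)
      where
        sel : Side → ℝ → ℝ
        sel inside  r = r
        sel outside r = 0ℝ

  LatticeIn : ∀ {d} → ℝ → (Vec ℝ d → Set) → Vec ℤ d → Set
  LatticeIn {d} t P z = Σ (Vec ℝ d) λ x → P x × (map fromℤ z ≡ map (t *_) x)

HasCard : ∀ {d} → (Vec ℤ d → Set) → ℕ → Set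
HasCard {d} P n = Σ (List (Vec ℤ d)) λ zs →
  (length zs ≡ n) × Unique zs × All P zs × (∀ z → P z → z ∈ zs)

sumSubsets : ∀ d → (Subset d → ℕ) → ℕ
sumSubsets zero    f = f []
sumSubsets (suc d) f = sumSubsets d (λ I → f (inside ∷ I)) ℕ.+ sumSubsets d (λ I → f (outside ∷ I))

-- A lattice point z lies in tC_I exactly when it vanishes outside I and |z| = (|z_1|, …, |z_d|)
-- lies in tS.  Hence Σ_I |tC_I ∩ ℤ^d| counts the pairs (I, z) with |z| ∈ tS ∩ ℤ^d and supp z ⊆ I.
-- Over a fixed y ∈ tS ∩ ℤ^d these pairs are chosen coordinatewise, and every coordinate offers
-- exactly two choices: if y_i = 0 then z_i = 0 and i ∈ I or i ∉ I; if y_i > 0 then i ∈ I and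
-- z_i = ±y_i.  So every y is counted 2^d times.
module Submission where

open import Defs
open import Data.Nat using (ℕ; _^_) renaming (_≤_ to _≤ℕ_; _*_ to _*ℕ_)
open import Data.Vec using (Vec; lookup)
open import Data.Fin.Subset using (Subset)
open import Relation.Binary.PropositionalEquality using (_≡_)

open import Data.Nat as ℕ using (zero; suc)
import Data.Nat.Properties as ℕ
open import Data.Integer as ℤ using (ℤ; +_; -[1+_])
open import Data.Fin using (Fin)
open import Data.Fin.Subset using (Side; inside; outside)
open import Data.Vec using ([]; _∷_; map; tabulate)
import Data.Vec.Properties as Vec
open import Data.List as List using (List; length; _++_; concatMap; cartesianProductWith)
import Data.List.Properties as List
open import Data.List.Relation.Unary.All as All using (All)
open import Data.List.Relation.Unary.AllPairs using (AllPairs)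
open import Data.List.Relation.Unary.Any using (here; there)
open import Data.List.Relation.Unary.Unique.Propositional using (Unique)
import Data.List.Relation.Unary.Unique.Propositional.Properties as Unique
open import Data.List.Membership.Propositional using (_∈_)
open import Data.List.Membership.Propositional.Properties
  using (∈-++⁺ˡ; ∈-++⁺ʳ; ∈-++⁻; ∈-cartesianProductWith⁺; ∈-cartesianProductWith⁻)
open import Data.List.Membership.Propositional.Properties.WithK using (unique∧set⇒bag)
open import Data.List.Relation.Binary.BagAndSetEquality using (∼bag⇒↭)
open import Data.List.Relation.Binary.Permutation.Propositional.Properties using (↭-length)
open import Data.Product using (_×_; _,_; proj₁; proj₂)
open import Data.Product.Function.NonDependent.Propositional using (_×-⇔_)
open import Data.Sum using (inj₁; inj₂)
open import Data.Empty using (⊥-elim)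
open import Relation.Nullary using (¬_)
open import Relation.Binary.PropositionalEquality
  using (_≢_; refl; sym; trans; cong; cong₂; subst; subst₂; module ≡-Reasoning)
open import Function using (_∘_; _⇔_; mk⇔; Equivalence)
import Function.Properties.Equivalence as ⇔
open import Algebra.Bundles using (Ring)
open import Algebra.Structures using (IsCommutativeRing)
open import Relation.Binary.Structures using (IsTotalOrder)
import Algebra.Properties.Ring as RingProperties
open import Algebra.Properties.CommutativeSemigroup ℕ.+-commutativeSemigroup
  using () renaming (interchange to +-interchange)

open Equivalence using (to; from)

SupportedIn : ∀ {A : Set} {d} → A → Subset d → Vec A d → Set
SupportedIn 0# I x = ∀ j → lookup I j ≡ outside → lookup x j ≡ 0#

supported-∷ : ∀ {A : Set} {d} {0# : A} {s c} {I : Subset d} {x} →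
              (s ≡ outside → c ≡ 0#) → SupportedIn 0# I x → SupportedIn 0# (s ∷ I) (c ∷ x)
supported-∷ head tail Fin.zero    = head
supported-∷ head tail (Fin.suc j) = tail j

absᵥ : ∀ {d} → Vec ℤ d → Vec ℤ d
absᵥ = map (λ c → + ℤ.∣ c ∣)

map-fixed : ∀ {A : Set} {d} {f : A → A} (xs : Vec A d) →
            (∀ i → f (lookup xs i) ≡ lookup xs i) → map f xs ≡ xs
map-fixed []       fixed = refl
map-fixed (x ∷ xs) fixed = cong₂ _∷_ (fixed Fin.zero) (map-fixed xs (fixed ∘ Fin.suc))

length-cartesianProductWith : ∀ {A B C : Set} (f : A → B → C) xs ys →
  length (cartesianProductWith f xs ys) ≡ length xs *ℕ length ys
length-cartesianProductWith f List.[]       ys = refl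
length-cartesianProductWith f (x List.∷ xs) ys = trans (List.length-++ (List.map (f x) ys))
  (cong₂ ℕ._+_ (List.length-map (f x) ys) (length-cartesianProductWith f xs ys))

HasCard-unique : ∀ {d} {P Q : Vec ℤ d → Set} {m n} →
                 (∀ z → P z ⇔ Q z) → HasCard P m → HasCard Q n → m ≡ n
HasCard-unique P⇔Q (xs , refl , xs! , Pxs , P⊆xs) (ys , refl , ys! , Qys , Q⊆ys) =
  ↭-length (∼bag⇒↭ (unique∧set⇒bag xs! ys! (mk⇔
    (λ z∈xs → Q⊆ys _ (to (P⇔Q _) (All.lookup Pxs z∈xs)))
    (λ z∈ys → P⊆xs _ (from (P⇔Q _) (All.lookup Qys z∈ys))))))

sumSubsets-cong : ∀ d {f g : Subset d → ℕ} → (∀ I → f I ≡ g I) → sumSubsets d f ≡ sumSubsets d g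
sumSubsets-cong zero    f≡g = f≡g []
sumSubsets-cong (suc d) f≡g =
  cong₂ ℕ._+_ (sumSubsets-cong d (f≡g ∘ (inside ∷_))) (sumSubsets-cong d (f≡g ∘ (outside ∷_)))

sumSubsets-zero : ∀ d → sumSubsets d (λ _ → 0) ≡ 0
sumSubsets-zero zero    = refl
sumSubsets-zero (suc d) = cong₂ ℕ._+_ (sumSubsets-zero d) (sumSubsets-zero d)

sumSubsets-+ : ∀ d (f g : Subset d → ℕ) →
               sumSubsets d (λ I → f I ℕ.+ g I) ≡ sumSubsets d f ℕ.+ sumSubsets d g
sumSubsets-+ zero    f g = refl
sumSubsets-+ (suc d) f g =
  trans (cong₂ ℕ._+_ (sumSubsets-+ d (f ∘ (inside ∷_)) (g ∘ (inside ∷_)))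
                     (sumSubsets-+ d (f ∘ (outside ∷_)) (g ∘ (outside ∷_))))
        (+-interchange (sumSubsets d (f ∘ (inside ∷_))) (sumSubsets d (g ∘ (inside ∷_)))
                       (sumSubsets d (f ∘ (outside ∷_))) (sumSubsets d (g ∘ (outside ∷_))))

sumSubsets-*ˡ : ∀ d k (f : Subset d → ℕ) → sumSubsets d (λ I → k *ℕ f I) ≡ k *ℕ sumSubsets d f
sumSubsets-*ˡ zero    k f = refl
sumSubsets-*ˡ (suc d) k f =
  trans (cong₂ ℕ._+_ (sumSubsets-*ˡ d k _) (sumSubsets-*ˡ d k _)) (sym (ℕ.*-distribˡ-+ k _ _))

signs : ℕ → Side → List ℤ
signs zero    s       = + 0 List.∷ List.[]
signs (suc n) inside  = + suc n List.∷ -[1+ n ] List.∷ List.[]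
signs (suc n) outside = List.[]

∈-signs⁻ : ∀ n s {c} → c ∈ signs n s → ℤ.∣ c ∣ ≡ n × (s ≡ outside → c ≡ + 0)
∈-signs⁻ zero    s      (here refl)         = refl , λ _ → refl
∈-signs⁻ (suc n) inside (here refl)         = refl , λ ()
∈-signs⁻ (suc n) inside (there (here refl)) = refl , λ ()

∈-signs⁺ : ∀ c s → (s ≡ outside → c ≡ + 0) → c ∈ signs ℤ.∣ c ∣ s
∈-signs⁺ (+ zero)  s       vanish = here refl
∈-signs⁺ (+ suc n) inside  vanish = here refl
∈-signs⁺ -[1+ n ]  inside  vanish = there (here refl)
∈-signs⁺ (+ suc n) outside vanish with () ← vanish refl
∈-signs⁺ -[1+ n ]  outside vanish with () ← vanish refl

signs-unique : ∀ n s → Unique (signs n s)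
signs-unique zero    s       = All.[] AllPairs.∷ AllPairs.[]
signs-unique (suc n) inside  = ((λ ()) All.∷ All.[]) AllPairs.∷ All.[] AllPairs.∷ AllPairs.[]
signs-unique (suc n) outside = AllPairs.[]

signs-count : ∀ n → length (signs n inside) ℕ.+ length (signs n outside) ≡ 2
signs-count zero    = refl
signs-count (suc n) = refl

fibre : ∀ {d} → Vec ℤ d → Subset d → List (Vec ℤ d)
fibre []      []      = [] List.∷ List.[]
fibre (c ∷ y) (s ∷ I) = cartesianProductWith _∷_ (signs ℤ.∣ c ∣ s) (fibre y I)

∈-fibre⁻ : ∀ {d} (y : Vec ℤ d) I {z} → z ∈ fibre y I → absᵥ z ≡ absᵥ y × SupportedIn (+ 0) I z
∈-fibre⁻ []      []      (here refl) = refl , λ ()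
∈-fibre⁻ (c ∷ y) (s ∷ I) z∈
  with c′ , w , c′∈ , w∈ , refl ← ∈-cartesianProductWith⁻ _∷_ (signs ℤ.∣ c ∣ s) (fibre y I) z∈
  with ∣c′∣≡∣c∣ , c′-vanishes ← ∈-signs⁻ ℤ.∣ c ∣ s c′∈
  with ∣w∣≡∣y∣ , w-supported ← ∈-fibre⁻ y I w∈
  = cong₂ _∷_ (cong +_ ∣c′∣≡∣c∣) ∣w∣≡∣y∣ , supported-∷ c′-vanishes w-supported

∈-fibre⁺ : ∀ {d} (y : Vec ℤ d) I z → absᵥ z ≡ absᵥ y → SupportedIn (+ 0) I z → z ∈ fibre y I
∈-fibre⁺ []      []      []       _      _         = here refl
∈-fibre⁺ (c ∷ y) (s ∷ I) (c′ ∷ w) ∣z∣≡∣y∣ supported =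
  subst (λ k → c′ ∷ w ∈ cartesianProductWith _∷_ (signs k s) (fibre y I))
        (cong ℤ.∣_∣ (Vec.∷-injectiveˡ ∣z∣≡∣y∣))
        (∈-cartesianProductWith⁺ _∷_ (∈-signs⁺ c′ s (supported Fin.zero))
          (∈-fibre⁺ y I w (Vec.∷-injectiveʳ ∣z∣≡∣y∣) (supported ∘ Fin.suc)))

fibre-unique : ∀ {d} (y : Vec ℤ d) I → Unique (fibre y I)
fibre-unique []      []      = All.[] AllPairs.∷ AllPairs.[]
fibre-unique (c ∷ y) (s ∷ I) =
  Unique.cartesianProductWith⁺ _∷_ Vec.∷-injective (signs-unique ℤ.∣ c ∣ s) (fibre-unique y I)

sum-length-fibre : ∀ {d} (y : Vec ℤ d) → sumSubsets d (λ I → length (fibre y I)) ≡ 2 ^ d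
sum-length-fibre []              = refl
sum-length-fibre {suc d} (c ∷ y) = begin
  ∑ (λ I → length (fibre (c ∷ y) (inside ∷ I))) ℕ.+ ∑ (λ I → length (fibre (c ∷ y) (outside ∷ I)))
    ≡⟨ cong₂ ℕ._+_ (sumSubsets-cong d (product-length inside)) (sumSubsets-cong d (product-length outside)) ⟩
  ∑ (λ I → ∣ inside ∣ *ℕ length (fibre y I)) ℕ.+ ∑ (λ I → ∣ outside ∣ *ℕ length (fibre y I))
    ≡⟨ cong₂ ℕ._+_ (sumSubsets-*ˡ d ∣ inside ∣ _) (sumSubsets-*ˡ d ∣ outside ∣ _) ⟩
  ∣ inside ∣ *ℕ ∑ (λ I → length (fibre y I)) ℕ.+ ∣ outside ∣ *ℕ ∑ (λ I → length (fibre y I))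
    ≡⟨ ℕ.*-distribʳ-+ _ ∣ inside ∣ ∣ outside ∣ ⟨
  (∣ inside ∣ ℕ.+ ∣ outside ∣) *ℕ ∑ (λ I → length (fibre y I))
    ≡⟨ cong₂ _*ℕ_ (signs-count ℤ.∣ c ∣) (sum-length-fibre y) ⟩
  2 *ℕ 2 ^ d ∎
  where
  open ≡-Reasoning
  ∑ : (Subset d → ℕ) → ℕ
  ∑ = sumSubsets d
  ∣_∣ : Side → ℕ
  ∣ s ∣ = length (signs ℤ.∣ c ∣ s)
  product-length : ∀ s I → length (fibre (c ∷ y) (s ∷ I)) ≡ ∣ s ∣ *ℕ length (fibre y I)
  product-length s I = length-cartesianProductWith _∷_ (signs ℤ.∣ c ∣ s) (fibre y I)

module _ {d : ℕ} where
  Fixed : Vec ℤ d → Set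
  Fixed y = absᵥ y ≡ y

  fibres : List (Vec ℤ d) → Subset d → List (Vec ℤ d)
  fibres ys I = concatMap (λ y → fibre y I) ys

  ∈-fibres⁻ : ∀ {ys} I {z} → All Fixed ys → z ∈ fibres ys I → SupportedIn (+ 0) I z × absᵥ z ∈ ys
  ∈-fibres⁻ {y List.∷ ys} I (y-fixed All.∷ ys-fixed) z∈ with ∈-++⁻ (fibre y I) z∈
  ... | inj₁ z∈fibre = let ∣z∣≡∣y∣ , supported = ∈-fibre⁻ y I z∈fibre
                       in supported , here (trans ∣z∣≡∣y∣ y-fixed)
  ... | inj₂ z∈rest  = let supported , ∣z∣∈ys = ∈-fibres⁻ I ys-fixed z∈rest
                       in supported , there ∣z∣∈ys

  ∈-fibres⁺ : ∀ {ys} I {z} → All Fixed ys → SupportedIn (+ 0) I z → absᵥ z ∈ ys → z ∈ fibres ys I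
  ∈-fibres⁺ {y List.∷ ys} I {z} (y-fixed All.∷ _) supported (here ∣z∣≡y) =
    ∈-++⁺ˡ (∈-fibre⁺ y I z (trans ∣z∣≡y (sym y-fixed)) supported)
  ∈-fibres⁺ {y List.∷ ys} I (_ All.∷ ys-fixed) supported (there ∣z∣∈ys) =
    ∈-++⁺ʳ (fibre y I) (∈-fibres⁺ I ys-fixed supported ∣z∣∈ys)

  fibres-unique : ∀ {ys} I → Unique ys → All Fixed ys → Unique (fibres ys I)
  fibres-unique {List.[]}     I _                _ = AllPairs.[]
  fibres-unique {y List.∷ ys} I (y∉ys AllPairs.∷ ys!) (y-fixed All.∷ ys-fixed) =
    Unique.++⁺ (fibre-unique y I) (fibres-unique I ys! ys-fixed) disjoint
    where
    disjoint : ∀ {z} → ¬ (z ∈ fibre y I × z ∈ fibres ys I)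
    disjoint (z∈fibre , z∈rest) =
      All.lookup y∉ys (subst (_∈ ys) (trans (proj₁ (∈-fibre⁻ y I z∈fibre)) y-fixed)
                                     (proj₂ (∈-fibres⁻ I ys-fixed z∈rest))) refl

  sum-length-fibres : ∀ ys → sumSubsets d (λ I → length (fibres ys I)) ≡ 2 ^ d *ℕ length ys
  sum-length-fibres List.[]       = trans (sumSubsets-zero d) (sym (ℕ.*-zeroʳ (2 ^ d)))
  sum-length-fibres (y List.∷ ys) = begin
    sumSubsets d (λ I → length (fibre y I ++ fibres ys I))
      ≡⟨ sumSubsets-cong d (λ I → List.length-++ (fibre y I)) ⟩
    sumSubsets d (λ I → length (fibre y I) ℕ.+ length (fibres ys I))
      ≡⟨ sumSubsets-+ d _ _ ⟩
    sumSubsets d (λ I → length (fibre y I)) ℕ.+ sumSubsets d (λ I → length (fibres ys I))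
      ≡⟨ cong₂ ℕ._+_ (sum-length-fibre y) (sum-length-fibres ys) ⟩
    2 ^ d ℕ.+ 2 ^ d *ℕ length ys
      ≡⟨ ℕ.*-suc (2 ^ d) (length ys) ⟨
    2 ^ d *ℕ length (y List.∷ ys) ∎
    where open ≡-Reasoning

  fibres-hasCard : ∀ {ys} → Unique ys → All Fixed ys → ∀ I →
    HasCard (λ z → SupportedIn (+ 0) I z × absᵥ z ∈ ys) (length (fibres ys I))
  fibres-hasCard {ys} ys! ys-fixed I =
    fibres ys I , refl , fibres-unique I ys! ys-fixed ,
    All.tabulate (∈-fibres⁻ I ys-fixed) ,
    λ z (supported , ∣z∣∈ys) → ∈-fibres⁺ I ys-fixed supported ∣z∣∈ys

module Reals (R : RealNumbers) where
  open RealNumbers R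
  open IsCommutativeRing isCommutativeRing
    using (isRing; +-identityˡ; +-comm; *-identityˡ; *-identityʳ; *-comm; *-assoc; zeroˡ; zeroʳ;
           -‿inverseˡ; -‿inverseʳ)
  open IsTotalOrder isTotalOrder using (total; antisym) renaming (refl to ≤-refl; trans to ≤-trans)

  ring : Ring _ _
  ring = record { isRing = isRing }
  open RingProperties ring using (-‿distribʳ-*; -‿involutive; -0#≈0#)

  x≤0⇒0≤-x : ∀ {x} → x ≤ 0ℝ → 0ℝ ≤ - x
  x≤0⇒0≤-x {x} x≤0 = subst₂ _≤_ (-‿inverseʳ x) (+-identityˡ (- x)) (+-mono-≤ x 0ℝ (- x) x≤0)

  0≤-x⇒x≤0 : ∀ {x} → 0ℝ ≤ - x → x ≤ 0ℝ
  0≤-x⇒x≤0 {x} 0≤-x = subst₂ _≤_ (+-identityˡ x) (-‿inverseˡ x) (+-mono-≤ 0ℝ (- x) x 0≤-x)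

  0≤1 : 0ℝ ≤ 1ℝ
  0≤1 with total 0ℝ 1ℝ
  ... | inj₁ 0≤1 = 0≤1
  ... | inj₂ 1≤0 = subst (0ℝ ≤_) -1*-1≡1 (*-nonneg (- 1ℝ) (- 1ℝ) (x≤0⇒0≤-x 1≤0) (x≤0⇒0≤-x 1≤0))
    where
    -1*-1≡1 : (- 1ℝ) * (- 1ℝ) ≡ 1ℝ
    -1*-1≡1 = trans (sym (-‿distribʳ-* (- 1ℝ) 1ℝ)) (trans (cong -_ (*-identityʳ (- 1ℝ))) (-‿involutive 1ℝ))

  0≤+ : ∀ {x y} → 0ℝ ≤ x → 0ℝ ≤ y → 0ℝ ≤ x + y
  0≤+ {x} {y} 0≤x 0≤y = ≤-trans (subst (0ℝ ≤_) (sym (+-identityˡ y)) 0≤y) (+-mono-≤ 0ℝ x y 0≤x)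

  0≤fromℕ : ∀ n → 0ℝ ≤ fromℕ n
  0≤fromℕ zero    = ≤-refl
  0≤fromℕ (suc n) = 0≤+ 0≤1 (0≤fromℕ n)

  1+n≰0 : ∀ n → ¬ (1ℝ + fromℕ n ≤ 0ℝ)
  1+n≰0 n 1+n≤0 = 0≢1 (antisym 0≤1 (≤-trans 1≤1+n 1+n≤0))
    where
    1≤1+n : 1ℝ ≤ 1ℝ + fromℕ n
    1≤1+n = subst₂ _≤_ (+-identityˡ 1ℝ) (+-comm (fromℕ n) 1ℝ) (+-mono-≤ 0ℝ (fromℕ n) 1ℝ (0≤fromℕ n))

  1+n≢0 : ∀ n → 1ℝ + fromℕ n ≢ 0ℝ
  1+n≢0 n 1+n≡0 = 1+n≰0 n (subst (_≤ 0ℝ) (sym 1+n≡0) ≤-refl)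

  fromℤ≡0⇒≡0 : ∀ c → fromℤ c ≡ 0ℝ → c ≡ + 0
  fromℤ≡0⇒≡0 (+ zero)  _  = refl
  fromℤ≡0⇒≡0 (+ suc n) eq = ⊥-elim (1+n≢0 n eq)
  fromℤ≡0⇒≡0 -[1+ n ]  eq = ⊥-elim (1+n≢0 n (trans (sym (-‿involutive _)) (trans (cong -_ eq) -0#≈0#)))

  0≤fromℤ⇒fixed : ∀ c → 0ℝ ≤ fromℤ c → + ℤ.∣ c ∣ ≡ c
  0≤fromℤ⇒fixed (+ n)     _      = refl
  0≤fromℤ⇒fixed -[1+ n ] 0≤-1-n = ⊥-elim (1+n≰0 n (0≤-x⇒x≤0 0≤-1-n))

  ∣fromℤ∣ : ∀ c → ∣ fromℤ c ∣ ≡ fromℤ (+ ℤ.∣ c ∣)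
  ∣fromℤ∣ (+ n)     = abs-nonneg _ (0≤fromℕ n)
  ∣fromℤ∣ -[1+ n ] = trans (abs-nonpos _ (0≤-x⇒x≤0 0≤1+n)) (-‿involutive _)
    where
    0≤1+n : 0ℝ ≤ - fromℤ -[1+ n ]
    0≤1+n = subst (0ℝ ≤_) (sym (-‿involutive _)) (0≤fromℕ (suc n))

  0≤∣x∣ : ∀ x → 0ℝ ≤ ∣ x ∣
  0≤∣x∣ x with total 0ℝ x
  ... | inj₁ 0≤x = subst (0ℝ ≤_) (sym (abs-nonneg x 0≤x)) 0≤x
  ... | inj₂ x≤0 = subst (0ℝ ≤_) (sym (abs-nonpos x x≤0)) (x≤0⇒0≤-x x≤0)

  ∣0∣ : ∣ 0ℝ ∣ ≡ 0ℝ
  ∣0∣ = abs-nonneg 0ℝ ≤-refl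

  *-nonpos : ∀ {t x} → 0ℝ ≤ t → x ≤ 0ℝ → t * x ≤ 0ℝ
  *-nonpos {t} {x} 0≤t x≤0 =
    0≤-x⇒x≤0 (subst (0ℝ ≤_) (sym (-‿distribʳ-* t x)) (*-nonneg t (- x) 0≤t (x≤0⇒0≤-x x≤0)))

  ∣t*x∣ : ∀ {t} x → 0ℝ ≤ t → ∣ t * x ∣ ≡ t * ∣ x ∣
  ∣t*x∣ {t} x 0≤t with total 0ℝ x
  ... | inj₁ 0≤x = trans (abs-nonneg (t * x) (*-nonneg t x 0≤t 0≤x)) (cong (t *_) (sym (abs-nonneg x 0≤x)))
  ... | inj₂ x≤0 = trans (abs-nonpos (t * x) (*-nonpos 0≤t x≤0))
                         (trans (-‿distribʳ-* t x) (cong (t *_) (sym (abs-nonpos x x≤0))))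

  module _ {t : ℝ} (t≢0 : t ≢ 0ℝ) where
    x*[x⁻¹*y]≡y : ∀ y → t * (t ⁻¹ * y) ≡ y
    x*[x⁻¹*y]≡y y = trans (sym (*-assoc t (t ⁻¹) y)) (trans (cong (_* y) (⁻¹-inverse t t≢0)) (*-identityˡ y))

    x⁻¹*[x*y]≡y : ∀ y → t ⁻¹ * (t * y) ≡ y
    x⁻¹*[x*y]≡y y = trans (sym (*-assoc (t ⁻¹) t y))
      (trans (cong (_* y) (trans (*-comm (t ⁻¹) t) (⁻¹-inverse t t≢0))) (*-identityˡ y))

    0≤x⇒0≤x⁻¹ : 0ℝ ≤ t → 0ℝ ≤ t ⁻¹
    0≤x⇒0≤x⁻¹ 0≤t with total 0ℝ (t ⁻¹)
    ... | inj₁ 0≤t⁻¹ = 0≤t⁻¹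
    ... | inj₂ t⁻¹≤0 = ⊥-elim (0≢1 (antisym 0≤1 (subst (_≤ 0ℝ) (⁻¹-inverse t t≢0) (*-nonpos 0≤t t⁻¹≤0))))

    contract : ∀ {d} → Vec ℤ d → Vec ℝ d
    contract = map (λ c → t ⁻¹ * fromℤ c)

    latticeIn⇔ : ∀ {d} {P : Vec ℝ d → Set} z → LatticeIn t P z ⇔ P (contract z)
    latticeIn⇔ {P = P} z = mk⇔
      (λ (x , Px , z≡tx) → subst P (x≡contract x z≡tx) Px)
      (λ Pcz → contract z , Pcz , sym t*contract)
      where
      open ≡-Reasoning
      x≡contract : ∀ x → map fromℤ z ≡ map (t *_) x → x ≡ contract z
      x≡contract x z≡tx = begin
        x                              ≡⟨ Vec.map-id x ⟨
        map (λ y → y) x                ≡⟨ Vec.map-cong x⁻¹*[x*y]≡y x ⟨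
        map (λ y → t ⁻¹ * (t * y)) x   ≡⟨ Vec.map-∘ (t ⁻¹ *_) (t *_) x ⟩
        map (t ⁻¹ *_) (map (t *_) x)   ≡⟨ cong (map (t ⁻¹ *_)) z≡tx ⟨
        map (t ⁻¹ *_) (map fromℤ z)    ≡⟨ Vec.map-∘ (t ⁻¹ *_) fromℤ z ⟨
        contract z                     ∎
      t*contract : map (t *_) (contract z) ≡ map fromℤ z
      t*contract = trans (sym (Vec.map-∘ (t *_) _ z)) (Vec.map-cong (x*[x⁻¹*y]≡y ∘ fromℤ) z)

    contract-supported⇔ : ∀ {d} I (z : Vec ℤ d) → SupportedIn 0ℝ I (contract z) ⇔ SupportedIn (+ 0) I z
    contract-supported⇔ I z = mk⇔
      (λ supported j j∉I → fromℤ≡0⇒≡0 _ (begin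
        fromℤ (lookup z j)                 ≡⟨ x*[x⁻¹*y]≡y _ ⟨
        t * (t ⁻¹ * fromℤ (lookup z j))    ≡⟨ cong (t *_) (trans (sym (Vec.lookup-map j _ z)) (supported j j∉I)) ⟩
        t * 0ℝ                             ≡⟨ zeroʳ t ⟩
        0ℝ                                 ∎))
      (λ supported j j∉I → begin
        lookup (contract z) j              ≡⟨ Vec.lookup-map j _ z ⟩
        t ⁻¹ * fromℤ (lookup z j)          ≡⟨ cong (λ c → t ⁻¹ * fromℤ c) (supported j j∉I) ⟩
        t ⁻¹ * 0ℝ                          ≡⟨ zeroʳ (t ⁻¹) ⟩
        0ℝ                                 ∎)
      where open ≡-Reasoning

    ∣contract∣ : 0ℝ ≤ t → ∀ {d} (z : Vec ℤ d) → map ∣_∣ (contract z) ≡ contract (absᵥ z)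
    ∣contract∣ 0≤t z = begin
      map ∣_∣ (contract z)                     ≡⟨ Vec.map-∘ ∣_∣ _ z ⟨
      map (λ c → ∣ t ⁻¹ * fromℤ c ∣) z          ≡⟨ Vec.map-cong ∣t⁻¹*fromℤ∣ z ⟩
      map (λ c → t ⁻¹ * fromℤ (+ ℤ.∣ c ∣)) z    ≡⟨ Vec.map-∘ _ _ z ⟩
      contract (absᵥ z)                        ∎
      where
      open ≡-Reasoning
      ∣t⁻¹*fromℤ∣ : ∀ c → ∣ t ⁻¹ * fromℤ c ∣ ≡ t ⁻¹ * fromℤ (+ ℤ.∣ c ∣)
      ∣t⁻¹*fromℤ∣ c = trans (∣t*x∣ (fromℤ c) (0≤x⇒0≤x⁻¹ 0≤t)) (cong (t ⁻¹ *_) (∣fromℤ∣ c))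

  module _ {d} (a : Vec ℝ d) where
    open Simplex a

    -- Defs keeps the case split on I inside the sum local to C; its summand is recovered from
    -- the type of C by unification.
    C-summand : Subset d → Vec ℝ d → Fin d → ℝ
    C-summand I x = summandOf (refl {x = C I x})
      where
      summandOf : ∀ {f : Fin d → ℝ} {B P : Set} → P ≡ ((sumℝ (tabulate f) ≤ 1ℝ) × B) → Fin d → ℝ
      summandOf {f} _ = f

    C-summand-supported : ∀ I x → SupportedIn 0ℝ I x → ∀ i → C-summand I x i ≡ ∣ lookup x i ∣ * lookup a i ⁻¹
    C-summand-supported I x supported i with lookup I i | supported i
    ... | inside  | _       = refl
    ... | outside | x[i]≡0 = begin
      0ℝ                              ≡⟨ zeroˡ _ ⟨
      0ℝ * lookup a i ⁻¹               ≡⟨ cong (_* lookup a i ⁻¹) (trans (cong ∣_∣ (x[i]≡0 refl)) ∣0∣) ⟨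
      ∣ lookup x i ∣ * lookup a i ⁻¹   ∎
      where open ≡-Reasoning

    C⇔supported×S-abs : ∀ I x → C I x ⇔ (SupportedIn 0ℝ I x × S (map ∣_∣ x))
    C⇔supported×S-abs I x = mk⇔
      (λ (bound , supported) → supported , ∣x∣-nonneg , subst (_≤ 1ℝ) (sums-equal supported) bound)
      (λ (supported , _ , bound) → subst (_≤ 1ℝ) (sym (sums-equal supported)) bound , supported)
      where
      ∣x∣-nonneg : ∀ i → 0ℝ ≤ lookup (map ∣_∣ x) i
      ∣x∣-nonneg i = subst (0ℝ ≤_) (sym (Vec.lookup-map i ∣_∣ x)) (0≤∣x∣ (lookup x i))
      sums-equal : SupportedIn 0ℝ I x →
        sumℝ (tabulate (C-summand I x)) ≡ sumℝ (tabulate λ i → lookup (map ∣_∣ x) i * lookup a i ⁻¹)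
      sums-equal supported = cong sumℝ (Vec.tabulate-cong λ i →
        trans (C-summand-supported I x supported i) (cong (_* lookup a i ⁻¹) (sym (Vec.lookup-map i ∣_∣ x))))

    module _ {t : ℝ} (0<t : 0ℝ < t) where
      private
        t≢0 : t ≢ 0ℝ
        t≢0 t≡0 = proj₂ 0<t (sym t≡0)

      latticeC⇔supported×latticeS-abs : ∀ I z →
        LatticeIn t (C I) z ⇔ (SupportedIn (+ 0) I z × LatticeIn t S (absᵥ z))
      latticeC⇔supported×latticeS-abs I z =
        ⇔.trans (latticeIn⇔ t≢0 z) (⇔.trans (C⇔supported×S-abs I (contract t≢0 z))
          (contract-supported⇔ t≢0 I z ×-⇔
            ⇔.trans (≡⇒⇔ S (∣contract∣ t≢0 (proj₁ 0<t) z)) (⇔.sym (latticeIn⇔ t≢0 (absᵥ z)))))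
        where
        ≡⇒⇔ : ∀ {A : Set} (P : A → Set) {x y} → x ≡ y → P x ⇔ P y
        ≡⇒⇔ P x≡y = mk⇔ (subst P x≡y) (subst P (sym x≡y))

      latticeS⇒fixed : ∀ y → LatticeIn t S y → absᵥ y ≡ y
      latticeS⇒fixed y y∈tS = map-fixed y λ i → 0≤fromℤ⇒fixed (lookup y i) (subst (0ℝ ≤_)
        (x*[x⁻¹*y]≡y t≢0 _)
        (*-nonneg t _ (proj₁ 0<t) (subst (0ℝ ≤_) (Vec.lookup-map i _ y) (proj₁ (to (latticeIn⇔ t≢0 y) y∈tS) i))))

proposition1 : (R : RealNumbers) → let open RealNumbers R in
    (d : ℕ) → 1 ≤ℕ d → (a : Vec ℝ d) → (∀ i → 0ℝ < lookup a i) →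
    (t : ℝ) → 0ℝ < t →
    (n : ℕ) → (m : Subset d → ℕ) →
    HasCard (LatticeIn t (Simplex.S a)) n →
    (∀ I → HasCard (LatticeIn t (Simplex.C a I)) (m I)) →
    2 ^ d *ℕ n ≡ sumSubsets d m
proposition1 R d _ a _ t 0<t n m (zs , refl , zs! , zs⊆tS , tS⊆zs) tC-card = begin
  2 ^ d *ℕ length zs                          ≡⟨ sum-length-fibres zs ⟨
  sumSubsets d (λ I → length (fibres zs I))   ≡⟨ sumSubsets-cong d fibres-count ⟩
  sumSubsets d m                              ∎
  where
  open ≡-Reasoning
  open RealNumbers R using (LatticeIn; module Simplex)
  open Reals R
  zs-fixed : All Fixed zs
  zs-fixed = All.map (latticeS⇒fixed a 0<t _) zs⊆tS
  fibres-count : ∀ I → length (fibres zs I) ≡ m I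
  fibres-count I = HasCard-unique
    (λ z → mk⇔ (λ (supported , ∣z∣∈zs) → from (latticeC≡ z) (supported , All.lookup zs⊆tS ∣z∣∈zs))
               (λ z∈tC → let supported , ∣z∣∈tS = to (latticeC≡ z) z∈tC in supported , tS⊆zs _ ∣z∣∈tS))
    (fibres-hasCard zs! zs-fixed I) (tC-card I)
    where
    latticeC≡ : ∀ z → LatticeIn t (Simplex.C a I) z ⇔ (SupportedIn (+ 0) I z × LatticeIn t (Simplex.S a) (absᵥ z))
    latticeC≡ = latticeC⇔supported×latticeS-abs a 0<t I
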